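{- Let $\mathcal{R}$ be a rewrite system on terms and let $\equiv$ be the congruence it generates. In atomic (symmetric) deduction modulo $\mathcal{R}$, a sequent $\Gamma \vdash \Delta$ is provable if and only if there are a proposition $A$ in $\Gamma$ and a proposition $B$ in $\Delta$ such that $A \equiv B$.
   Context: Fix a first-order language. A rewrite rule is a pair of terms $\langle l, r\rangle$, written $l \rightarrow r$, where $l$ is not a variable; a rewrite system is a set of rewrite rules. The relation $\rightarrow^{1}$ is the smallest relation on terms and on propositions that is compatible with the structure of terms and propositions (i.e. closed under placing in any context) and such that $\theta l \rightarrow^{1} \theta r$ for every substitution $\theta$ and every rule $l \rightarrow r$. The relation $\equiv$ is the reflexive-symmetric-transitive closure of $\rightarrow^{1}$. Sequents $\Gamma \vdash \Delta$ have finite multisets $\Gamma,\Delta$ of propositions. Atomic (symmetric) deduction modulo $\mathcal{R}$ is the proof system in which all propositions are atomic and whose only rules are: Axiom: $\Gamma, A_1 \vdash A_2, \Delta$ with no premise, provided $A_1 \equiv A_2$; Cut: from $\Gamma \vdash C_1, \Delta$ and $\Gamma, C_2 \vdash \Delta$ infer $\Gamma \vdash \Delta$, provided $C_1 \equiv C_2$; contraction-left: from $\Gamma, A_1, A_2 \vdash \Delta$ infer $\Gamma, A \vdash \Delta$ provided $A_1 \equiv A \equiv A_2$; contraction-right: from $\Gamma \vdash A_1, A_2, \Delta$ infer $\Gamma \vdash A, \Delta$ provided $A_1 \equiv A \equiv A_2$; weakening-left: from $\Gamma \vdash \Delta$ infer $\Gamma, A \vdash \Delta$; weakening-right: from $\Gamma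 \vdash \Delta$ infer $\Gamma \vdash A, \Delta$. -}

module Defs where

open import Data.Nat using (ℕ)
open import Data.Fin using (Fin)
open import Data.Vec using (Vec; []; _∷_; lookup; _[_]≔_)
open import Data.List using (List; _∷_)
open import Data.List.Relation.Binary.Permutation.Propositional using (_↭_)
open import Relation.Binary.Construct.Closure.Equivalence using (EqClosure)
open import Relation.Nullary using (¬_)
open import Data.Unit using (⊤)
open import Data.Empty using (⊥)

record Signature : Set₁ where
  field
    Fun    : Set
    fArity : Fun → ℕ
    Pred   : Set
    pArity : Pred → ℕ

module _ (S : Signature) where
  open Signature S

  data Term : Set where
    var : ℕ → Term
    fn  : (f : Fun) → Vec Term (fArity f) → Term

  -- Propositions (only atomic ones are used in atomic deduction modulo).
  data Prop : Set where
    atom : (p : Pred) → Vec Term (pArity p) → Prop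

  Subst : Set
  Subst = ℕ → Term

  mutual
    subst : Subst → Term → Term
    subst θ (var x)   = θ x
    subst θ (fn f ts) = fn f (substs θ ts)

    substs : ∀ {n} → Subst → Vec Term n → Vec Term n
    substs θ []       = []
    substs θ (t ∷ ts) = subst θ t ∷ substs θ ts

  IsVar : Term → Set
  IsVar (var _)  = ⊤
  IsVar (fn _ _) = ⊥

  RewriteSystem : Set₁
  RewriteSystem = Term → Term → Set

  WellFormed : RewriteSystem → Set
  WellFormed R = ∀ l r → R l r → ¬ IsVar l

  module _ (R : RewriteSystem) where

    data _⟶₁_ : Term → Term → Set where
      root : ∀ {l r} (θ : Subst) → R l r → subst θ l ⟶₁ subst θ r
      arg  : ∀ {f} (ts : Vec Term (fArity f)) (i : Fin (fArity f)) {u : Term} →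
             lookup ts i ⟶₁ u → fn f ts ⟶₁ fn f (ts [ i ]≔ u)

    data _⟶₁ᵖ_ : Prop → Prop → Set where
      arg : ∀ {p} (ts : Vec Term (pArity p)) (i : Fin (pArity p)) {u : Term} →
            lookup ts i ⟶₁ u → atom p ts ⟶₁ᵖ atom p (ts [ i ]≔ u)

    _≡ᴿ_ : Prop → Prop → Set
    _≡ᴿ_ = EqClosure _⟶₁ᵖ_

    -- Atomic (symmetric) deduction modulo R.  Sequents are pairs of lists
    -- read as multisets: every rule's conclusion is matched up to permutation (↭).
    data _⊢_ : List Prop → List Prop → Set where
      axiom : ∀ {Γ Δ Γ' Δ' A₁ A₂} →
              Γ ↭ (A₁ ∷ Γ') → Δ ↭ (A₂ ∷ Δ') → A₁ ≡ᴿ A₂ → Γ ⊢ Δ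
      cut   : ∀ {Γ Δ C₁ C₂} →
              Γ ⊢ (C₁ ∷ Δ) → (C₂ ∷ Γ) ⊢ Δ → C₁ ≡ᴿ C₂ → Γ ⊢ Δ
      contrL : ∀ {Γ Γ' Δ A A₁ A₂} →
              (A₁ ∷ A₂ ∷ Γ') ⊢ Δ → A₁ ≡ᴿ A → A ≡ᴿ A₂ → Γ ↭ (A ∷ Γ') → Γ ⊢ Δ
      contrR : ∀ {Γ Δ Δ' A A₁ A₂} →
              Γ ⊢ (A₁ ∷ A₂ ∷ Δ') → A₁ ≡ᴿ A → A ≡ᴿ A₂ → Δ ↭ (A ∷ Δ') → Γ ⊢ Δ
      weakL : ∀ {Γ Γ' Δ A} → Γ' ⊢ Δ → Γ ↭ (A ∷ Γ') → Γ ⊢ Δ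
      weakR : ∀ {Γ Δ Δ' A} → Γ ⊢ Δ' → Δ ↭ (A ∷ Δ') → Γ ⊢ Δ

-- Every rule of atomic deduction modulo preserves the invariant "some A ∈ Γ and
-- B ∈ Δ satisfy A ≡ B": an axiom establishes it, weakening and contraction carry
-- it along, and a cut whose cut formula is the only link on both sides chains the
-- two links through C₁ ≡ C₂.  Conversely such a pair is an instance of the axiom.
module Submission where

open import Defs
open import Data.List using (List; _∷_; _++_)
open import Data.List.Membership.Propositional using (_∈_)
open import Data.List.Membership.Propositional.Properties using (∈-∃++)
open import Data.List.Relation.Unary.Any using (here; there)
open import Data.List.Relation.Binary.Permutation.Propositional using (_↭_; ↭-sym)
open import Data.List.Relation.Binary.Permutation.Propositional.Properties using (∈-resp-↭; shift)
open import Relation.Binary.Construct.Closure.Equivalence using (symmetric; transitive)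
open import Relation.Binary.PropositionalEquality using (refl)
open import Data.Product using (Σ; _×_; _,_)
open import Function.Bundles using (_⇔_; mk⇔)

∈⇒↭∷ : ∀ {a} {A : Set a} {x : A} {xs : List A} → x ∈ xs → Σ (List A) (λ ys → xs ↭ x ∷ ys)
∈⇒↭∷ x∈xs with ys , zs , refl ← ∈-∃++ x∈xs = ys ++ zs , shift _ ys zs

∈-resp-↭∷ : ∀ {a} {A : Set a} {x y : A} {xs ys : List A} → xs ↭ x ∷ ys → y ∈ x ∷ ys → y ∈ xs
∈-resp-↭∷ xs↭ = ∈-resp-↭ (↭-sym xs↭)

module _ (S : Signature) (R : RewriteSystem S) where

  private
    _≈_ : Prop S → Prop S → Set
    _≈_ = _≡ᴿ_ S R

    ≈-sym : ∀ {A B} → A ≈ B → B ≈ A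
    ≈-sym = symmetric (_⟶₁ᵖ_ S R)

    ≈-trans : ∀ {A B C} → A ≈ B → B ≈ C → A ≈ C
    ≈-trans = transitive (_⟶₁ᵖ_ S R)

  Linked : List (Prop S) → List (Prop S) → Set
  Linked Γ Δ = Σ (Prop S) (λ A → Σ (Prop S) (λ B → A ∈ Γ × B ∈ Δ × A ≈ B))

  ⊢⇒Linked : ∀ {Γ Δ} → _⊢_ S R Γ Δ → Linked Γ Δ
  ⊢⇒Linked (axiom Γ↭ Δ↭ A₁≈A₂) = _ , _ , ∈-resp-↭∷ Γ↭ (here refl) , ∈-resp-↭∷ Δ↭ (here refl) , A₁≈A₂
  ⊢⇒Linked (cut ⊢C₁ C₂⊢ C₁≈C₂) with ⊢⇒Linked ⊢C₁ | ⊢⇒Linked C₂⊢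
  ... | A , B , A∈ , there B∈ , A≈B | _ = A , B , A∈ , B∈ , A≈B
  ... | _ , _ , _ , here refl , _ | A , B , there A∈ , B∈ , A≈B = A , B , A∈ , B∈ , A≈B
  ... | A , _ , A∈ , here refl , A≈C₁ | _ , B , here refl , B∈ , C₂≈B =
    A , B , A∈ , B∈ , ≈-trans A≈C₁ (≈-trans C₁≈C₂ C₂≈B)
  ⊢⇒Linked (contrL ⊢ A₁≈A A≈A₂ Γ↭) with ⊢⇒Linked ⊢
  ... | _ , B , here refl , B∈ , A₁≈B =
    _ , B , ∈-resp-↭∷ Γ↭ (here refl) , B∈ , ≈-trans (≈-sym A₁≈A) A₁≈B
  ... | _ , B , there (here refl) , B∈ , A₂≈B =
    _ , B , ∈-resp-↭∷ Γ↭ (here refl) , B∈ , ≈-trans A≈A₂ A₂≈B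
  ... | A , B , there (there A∈) , B∈ , A≈B = A , B , ∈-resp-↭∷ Γ↭ (there A∈) , B∈ , A≈B
  ⊢⇒Linked (contrR ⊢ A₁≈A A≈A₂ Δ↭) with ⊢⇒Linked ⊢
  ... | C , _ , C∈ , here refl , C≈A₁ =
    C , _ , C∈ , ∈-resp-↭∷ Δ↭ (here refl) , ≈-trans C≈A₁ A₁≈A
  ... | C , _ , C∈ , there (here refl) , C≈A₂ =
    C , _ , C∈ , ∈-resp-↭∷ Δ↭ (here refl) , ≈-trans C≈A₂ (≈-sym A≈A₂)
  ... | A , B , A∈ , there (there B∈) , A≈B = A , B , A∈ , ∈-resp-↭∷ Δ↭ (there B∈) , A≈B
  ⊢⇒Linked (weakL ⊢ Γ↭) with A , B , A∈ , B∈ , A≈B ← ⊢⇒Linked ⊢ =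
    A , B , ∈-resp-↭∷ Γ↭ (there A∈) , B∈ , A≈B
  ⊢⇒Linked (weakR ⊢ Δ↭) with A , B , A∈ , B∈ , A≈B ← ⊢⇒Linked ⊢ =
    A , B , A∈ , ∈-resp-↭∷ Δ↭ (there B∈) , A≈B

  Linked⇒⊢ : ∀ {Γ Δ} → Linked Γ Δ → _⊢_ S R Γ Δ
  Linked⇒⊢ (_ , _ , A∈ , B∈ , A≈B) with _ , Γ↭ ← ∈⇒↭∷ A∈ | _ , Δ↭ ← ∈⇒↭∷ B∈ = axiom Γ↭ Δ↭ A≈B

proposition1 : (S : Signature) (R : RewriteSystem S) → WellFormed S R →
    (Γ Δ : List (Prop S)) →
    _⊢_ S R Γ Δ ⇔ Σ (Prop S) (λ A → Σ (Prop S) (λ B → A ∈ Γ × B ∈ Δ × _≡ᴿ_ S R A B))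
proposition1 S R _ Γ Δ = mk⇔ (⊢⇒Linked S R) (Linked⇒⊢ S R)
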